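{- Let $d\in\mathbb{N}$ and let $G$ be a maximal graph homomorphic to $\Gamma_d$ (i.e., $G$ is homomorphic to $\Gamma_d$, and adding any edge between two nonadjacent vertices of $G$ yields a graph not homomorphic to $\Gamma_d$). If $I_1$ is a maximal independent set of $G$, then $G$ admits a proper $3$-coloring $\{I_1,I_2,I_3\}$ (a partition of $V(G)$ into three independent sets, one of which is $I_1$) such that $\overline{G}[I_2\cup I_3]$ has no induced cycle of length $4$.
   Context: A homomorphism from a graph $G$ to a graph $H$ is a map $h\colon V(G)\to V(H)$ with $h(u)h(v)\in E(H)$ for every $uv\in E(G)$; $G$ is homomorphic to $H$ if one exists. For $d\in\mathbb{N}$, the Andrásfai graph $\Gamma_d$ has vertex set $[3d-1]$ and edge set $\{xy : y = x+i \text{ for some } i\in\{d,\dots,2d-1\}\}$, arithmetic modulo $3d-1$. $\overline{G}$ is the complement of $G$ and $\overline{G}[S]$ the subgraph of $\overline{G}$ induced by $S$. -}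

module Defs where

open import Data.Nat using (ℕ; zero; suc; _+_; _*_; _∸_; _≤_; _<_)
open import Data.Nat.Properties using (+-comm; m+n∸n≡m)
open import Data.Nat.DivMod using (_%_; n%n≡0)
open import Data.Fin using (Fin; toℕ)
open import Data.Product using (Σ; _×_; _,_)
open import Data.Sum using (_⊎_; inj₁; inj₂)
open import Relation.Nullary using (¬_; Dec)
open import Relation.Nullary.Decidable using (_×-dec_; _⊎-dec_)
open import Data.Nat.Properties using (_≤?_; _<?_)
open import Data.Fin.Properties using (_≟_)
import Data.Fin.Subset as Sub
open import Relation.Unary using (Pred; _∈_; _∉_)
open import Relation.Binary.PropositionalEquality
  using (_≡_; _≢_; refl; subst; trans; cong)

record Graph : Set₁ where
  field
    V      : ℕ
    E      : Fin V → Fin V → Set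
    sym    : ∀ {x y} → E x y → E y x
    irrefl : ∀ {x} → ¬ E x x
    E?     : ∀ x y → Dec (E x y)
open Graph public

Hom : Graph → Graph → Set
Hom G H = Σ (Fin (V G) → Fin (V H)) λ h → ∀ x y → E G x y → E H (h x) (h y)

_⟶_ : Graph → Graph → Set
G ⟶ H = Hom G H

addEdge : (G : Graph) (u v : Fin (V G)) → u ≢ v → Graph
addEdge G u v u≢v = record
  { V = V G
  ; E = λ x y → E G x y ⊎ ((x ≡ u × y ≡ v) ⊎ (x ≡ v × y ≡ u))
  ; sym = λ { (inj₁ e) → inj₁ (sym G e)
            ; (inj₂ (inj₁ (p , q))) → inj₂ (inj₂ (q , p))
            ; (inj₂ (inj₂ (p , q))) → inj₂ (inj₁ (q , p)) }
  ; irrefl = λ { (inj₁ e) → irrefl G e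
               ; (inj₂ (inj₁ (refl , q))) → u≢v q
               ; (inj₂ (inj₂ (refl , q))) → u≢v (Relation.Binary.PropositionalEquality.sym q) }
  ; E? = λ x y → E? G x y ⊎-dec (((x ≟ u) ×-dec (y ≟ v)) ⊎-dec ((x ≟ v) ×-dec (y ≟ u)))
  }

MaximalHomTo : Graph → Graph → Set
MaximalHomTo G H =
  (G ⟶ H) × (∀ u v → (u≢v : u ≢ v) → ¬ E G u v → ¬ (addEdge G u v u≢v ⟶ H))

-- Andrásfai graph Γ_d, for d = suc k ≥ 1.  Vertex set Fin (3d-1), where
-- 3d - 1 = suc (suc (3 * k)).  Edge xy iff y = x + i (mod 3d-1) for
-- some i ∈ {d, …, 2d-1}; as edges are unordered pairs this is
-- "y ≡ x + i or x ≡ y + i".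

ΓStep : (k : ℕ) → Fin (suc (suc (3 * k))) → Fin (suc (suc (3 * k))) → Set
ΓStep k x y = (suc k ≤ r) × (r < 2 * suc k)
  where
  N = suc (suc (3 * k))
  r = (toℕ y + N ∸ toℕ x) % N

ΓAdj : (k : ℕ) → Fin (suc (suc (3 * k))) → Fin (suc (suc (3 * k))) → Set
ΓAdj k x y = ΓStep k x y ⊎ ΓStep k y x

private
  step-irrefl : ∀ k x → ¬ ΓStep k x x
  step-irrefl k x (d≤r , _) with
    trans (cong (_% suc (suc (3 * k))) (m+n∸n≡m' (toℕ x) (suc (suc (3 * k)))))
          (n%n≡0 (suc (suc (3 * k))))
    where
    m+n∸n≡m' : ∀ a b → a + b ∸ a ≡ b
    m+n∸n≡m' a b = trans (cong (_∸ a) (+-comm a b)) (m+n∸n≡m b a)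
  ... | eq with subst (suc k ≤_) eq d≤r
  ... | ()

  step? : ∀ k x y → Dec (ΓStep k x y)
  step? k x y = (suc k ≤? r) ×-dec (r <? 2 * suc k)
    where
    N = suc (suc (3 * k))
    r = (toℕ y + N ∸ toℕ x) % N

Andrasfai : ℕ → Graph
Andrasfai k = record
  { V = suc (suc (3 * k))
  ; E = ΓAdj k
  ; sym = λ { (inj₁ s) → inj₂ s ; (inj₂ s) → inj₁ s }
  ; irrefl = λ { {x} (inj₁ s) → step-irrefl k x s ; {x} (inj₂ s) → step-irrefl k x s }
  ; E? = λ x y → step? k x y ⊎-dec step? k y x
  }

VSet : Graph → Set
VSet G = Sub.Subset (V G)

Independent : (G : Graph) → VSet G → Set
Independent G S = ∀ x y → x Sub.∈ S → y Sub.∈ S → ¬ E G x y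

MaximalIndependent : (G : Graph) → VSet G → Set
MaximalIndependent G S =
  Independent G S × (∀ v → v Sub.∉ S → Σ (Fin (V G)) λ u → u Sub.∈ S × E G u v)

ProperColouring : (G : Graph) (m : ℕ) → (Fin (V G) → Fin m) → Set
ProperColouring G m c = ∀ x y → E G x y → c x ≢ c y

CoE : (G : Graph) → Fin (V G) → Fin (V G) → Set
CoE G x y = x ≢ y × ¬ E G x y

HasInducedC4InComplementOn : (G : Graph) → Pred (Fin (V G)) _ → Set
HasInducedC4InComplementOn G S =
  Σ (Fin (V G)) λ a → Σ (Fin (V G)) λ b → Σ (Fin (V G)) λ c → Σ (Fin (V G)) λ d →
    (a ∈ S × b ∈ S × c ∈ S × d ∈ S) ×
    (CoE G a b × CoE G b c × CoE G c d × CoE G d a) ×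
    (a ≢ c × ¬ CoE G a c) × (b ≢ d × ¬ CoE G b d)

-- Let h be a homomorphism G → Γ_d. Maximality of G means that h also reflects edges, so G is
-- described by the positions of its vertices on the cycle ℤ/(3d-1), two positions being adjacent
-- iff their cyclic distance lies in [d, 2d). An independent set of Γ_d lies in an arc of d
-- consecutive positions; rotating so that h(I₁) ⊆ [0, d), maximality of I₁ puts every other
-- vertex in [d, 3d-1), and the three arcs [0, d), [d, 2d), [2d, 3d-1) are the colour classes.
-- Between [d, 2d) and [2d, 3d-1) adjacency is the threshold relation x + d ≤ y, so two disjoint
-- edges across these classes always have a further edge between them: there is no induced 2K₂
-- in G[I₂ ∪ I₃], i.e. no induced C₄ in its complement.
module Submission where

open import Defs
open import Data.Nat using (ℕ)
open import Data.Fin using (Fin; zero; suc)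
open import Data.Fin.Subset using (_∈_)
open import Data.Product using (Σ; _×_; _,_)
open import Relation.Nullary using (¬_)
open import Relation.Binary.PropositionalEquality using (_≡_; _≢_)

open import Data.Nat using (suc; _+_; _*_; _∸_; _≤_; _<_; NonZero; z≤n; s≤s)
open import Data.Nat.Properties
open import Data.Nat.DivMod using (_%_; m%n<n; %-distribˡ-+; m%n%n≡m%n; [m+n]%n≡m%n; m<n⇒m%n≡m)
open import Data.Nat.Tactic.RingSolver using (solve-∀)
open import Data.Fin using (toℕ)
open import Data.Fin.Properties using (any?; toℕ<n) renaming (_≟_ to _≟ᶠ_)
open import Data.Fin.Subset using (Subset; _∉_)
open import Data.Fin.Subset.Properties using (_∈?_)
open import Data.List.Base using (List; filter; allFin)
open import Data.List.Extrema.Nat using (argmin; argmin-all; f[argmin]≤f[xs])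
import Data.List.Relation.Unary.All as All
open import Data.List.Relation.Unary.All.Properties using (all-filter)
open import Data.List.Membership.Propositional.Properties using (∈-filter⁺; ∈-allFin)
open import Data.Product using (proj₁; proj₂)
open import Data.Sum as Sum using (_⊎_; inj₁; inj₂)
open import Data.Empty using (⊥-elim)
open import Function using (_∘_)
open import Relation.Nullary using (yes; no; contradiction)
open import Relation.Binary.PropositionalEquality as ≡ using (refl; cong; module ≡-Reasoning)

addEdge-hom : ∀ G H (f : Hom G H) {u v} (u≢v : u ≢ v) →
              E H (proj₁ f u) (proj₁ f v) → Hom (addEdge G u v u≢v) H
addEdge-hom G H (f , f-hom) _ adj = f , λ where
  x y (inj₁ e)                    → f-hom x y e
  _ _ (inj₂ (inj₁ (refl , refl))) → adj
  _ _ (inj₂ (inj₂ (refl , refl))) → sym H adj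

maximal-reflects-edges : ∀ G H (mh : MaximalHomTo G H) u v →
                         E H (proj₁ (proj₁ mh) u) (proj₁ (proj₁ mh) v) → E G u v
maximal-reflects-edges G H (f , maximal) u v adj with E? G u v | u ≟ᶠ v
... | yes e | _        = e
... | no _  | yes refl = ⊥-elim (irrefl H adj)
... | no ¬e | no u≢v   = ⊥-elim (maximal u v u≢v ¬e (addEdge-hom G H f u≢v adj))

¬CoE⇒E : ∀ G {u v} → u ≢ v → ¬ CoE G u v → E G u v
¬CoE⇒E G {u} {v} u≢v ¬co with E? G u v
... | yes e = e
... | no ¬e = contradiction (u≢v , ¬e) ¬co

module ModularDifference (N : ℕ) .{{_ : NonZero N}} where

  infix 4 _≋_
  _≋_ : ℕ → ℕ → Set
  a ≋ b = a % N ≡ b % N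

  infixl 6 _⊖_
  _⊖_ : ℕ → ℕ → ℕ
  m ⊖ n = (m + N ∸ n) % N

  +-congʳ-≋ : ∀ {a b} c → a ≋ b → a + c ≋ b + c
  +-congʳ-≋ {a} {b} c a≋b = begin
    (a + c) % N             ≡⟨ %-distribˡ-+ a c N ⟩
    (a % N + c % N) % N     ≡⟨ cong (λ t → (t + c % N) % N) a≋b ⟩
    (b % N + c % N) % N     ≡⟨ %-distribˡ-+ b c N ⟨
    (b + c) % N             ∎
    where open ≡-Reasoning

  +-congˡ-≋ : ∀ a {b c} → b ≋ c → a + b ≋ a + c
  +-congˡ-≋ a {b} {c} b≋c = begin
    (a + b) % N   ≡⟨ cong (_% N) (+-comm a b) ⟩
    (b + a) % N   ≡⟨ +-congʳ-≋ a b≋c ⟩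
    (c + a) % N   ≡⟨ cong (_% N) (+-comm c a) ⟩
    (a + c) % N   ∎
    where open ≡-Reasoning

  m⊖n<N : ∀ m n → m ⊖ n < N
  m⊖n<N m n = m%n<n (m + N ∸ n) N

  m⊖n+n≋m : ∀ m {n} → n ≤ N → m ⊖ n + n ≋ m
  m⊖n+n≋m m {n} n≤N = begin
    ((m + N ∸ n) % N + n) % N   ≡⟨ +-congʳ-≋ n (m%n%n≡m%n (m + N ∸ n) N) ⟩
    (m + N ∸ n + n) % N         ≡⟨ cong (_% N) (m∸n+n≡m (≤-trans n≤N (m≤n+m N m))) ⟩
    (m + N) % N                 ≡⟨ [m+n]%n≡m%n m N ⟩
    m % N                       ∎
    where open ≡-Reasoning

  ⊖-unique : ∀ {m n z} → n ≤ N → z < N → z + n ≋ m → m ⊖ n ≡ z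
  ⊖-unique {m} {n} {z} n≤N z<N z+n≋m = begin
    (m + N ∸ n) % N         ≡⟨ cong (_% N) (+-∸-assoc m n≤N) ⟩
    (m + (N ∸ n)) % N       ≡⟨ +-congʳ-≋ (N ∸ n) z+n≋m ⟨
    (z + n + (N ∸ n)) % N   ≡⟨ cong (_% N) (≡.trans (+-assoc z n (N ∸ n)) (cong (z +_) (m+[n∸m]≡n n≤N))) ⟩
    (z + N) % N             ≡⟨ [m+n]%n≡m%n z N ⟩
    z % N                   ≡⟨ m<n⇒m%n≡m z<N ⟩
    z                       ∎
    where open ≡-Reasoning

  [m⊖o]⊖[n⊖o]≡m⊖n : ∀ m {n o} → n ≤ N → o ≤ N → (m ⊖ o) ⊖ (n ⊖ o) ≡ m ⊖ n
  [m⊖o]⊖[n⊖o]≡m⊖n m {n} {o} n≤N o≤N = ≡.sym (⊖-unique n≤N (m⊖n<N (m ⊖ o) (n ⊖ o)) (begin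
    (z + n) % N               ≡⟨ +-congˡ-≋ z (m⊖n+n≋m n o≤N) ⟨
    (z + (n ⊖ o + o)) % N     ≡⟨ cong (_% N) (+-assoc z (n ⊖ o) o) ⟨
    (z + (n ⊖ o) + o) % N     ≡⟨ +-congʳ-≋ o (m⊖n+n≋m (m ⊖ o) (<⇒≤ (m⊖n<N n o))) ⟩
    (m ⊖ o + o) % N           ≡⟨ m⊖n+n≋m m o≤N ⟩
    m % N                     ∎))
    where
    open ≡-Reasoning
    z : ℕ
    z = (m ⊖ o) ⊖ (n ⊖ o)

  n≤m⇒m⊖n≡m∸n : ∀ {m n} → n ≤ m → m < N → m ⊖ n ≡ m ∸ n
  n≤m⇒m⊖n≡m∸n {m} {n} n≤m m<N =
    ⊖-unique (<⇒≤ (≤-<-trans n≤m m<N)) (≤-<-trans (m∸n≤m m n) m<N) (cong (_% N) (m∸n+n≡m n≤m))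

  m<n⇒m⊖n≡N∸[n∸m] : ∀ {m n} → m < n → n < N → m ⊖ n ≡ N ∸ (n ∸ m)
  m<n⇒m⊖n≡N∸[n∸m] {m} {n} m<n n<N =
    ⊖-unique (<⇒≤ n<N) (∸-monoʳ-< (m<n⇒0<n∸m m<n) n∸m≤N) (begin
      (N ∸ (n ∸ m) + n) % N               ≡⟨ cong (λ t → (N ∸ (n ∸ m) + t) % N) (m+[n∸m]≡n (<⇒≤ m<n)) ⟨
      (N ∸ (n ∸ m) + (m + (n ∸ m))) % N   ≡⟨ cong (λ t → (N ∸ (n ∸ m) + t) % N) (+-comm m (n ∸ m)) ⟩
      (N ∸ (n ∸ m) + ((n ∸ m) + m)) % N   ≡⟨ cong (_% N) (+-assoc (N ∸ (n ∸ m)) (n ∸ m) m) ⟨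
      (N ∸ (n ∸ m) + (n ∸ m) + m) % N     ≡⟨ cong (λ t → (t + m) % N) (m∸n+n≡m n∸m≤N) ⟩
      (N + m) % N                         ≡⟨ cong (_% N) (+-comm N m) ⟩
      (m + N) % N                         ≡⟨ [m+n]%n≡m%n m N ⟩
      m % N                               ∎)
    where
    open ≡-Reasoning
    n∸m≤N : n ∸ m ≤ N
    n∸m≤N = ≤-trans (m∸n≤m n m) (<⇒≤ n<N)

  m⊖[m⊖n]≡n : ∀ m {n} → n < N → m ⊖ (m ⊖ n) ≡ n
  m⊖[m⊖n]≡n m {n} n<N = ⊖-unique (<⇒≤ (m⊖n<N m n)) n<N
    (≡.trans (cong (_% N) (+-comm n (m ⊖ n))) (m⊖n+n≋m m (<⇒≤ n<N)))

private
  3k+2≡k+2[k+1] : ∀ k → suc (suc (3 * k)) ≡ k + 2 * suc k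
  3k+2≡k+2[k+1] = solve-∀

  3k+3≡[k+1]+2[k+1] : ∀ k → suc (suc (suc (3 * k))) ≡ suc k + 2 * suc k
  3k+3≡[k+1]+2[k+1] = solve-∀

module AndrasfaiPositions (k : ℕ) where

  N d : ℕ
  N = suc (suc (3 * k))
  d = suc k

  open ModularDifference N public

  InBand : ℕ → Set
  InBand t = d ≤ t × t < 2 * d

  -- ΓAdj k x y is definitionally Adj (toℕ x) (toℕ y).
  Adj : ℕ → ℕ → Set
  Adj x y = InBand (y ⊖ x) ⊎ InBand (x ⊖ y)

  N≡k+2d : N ≡ k + 2 * d
  N≡k+2d = 3k+2≡k+2[k+1] k

  1+N≡d+2d : suc N ≡ d + 2 * d
  1+N≡d+2d = 3k+3≡[k+1]+2[k+1] k

  k<N : k < N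
  k<N = s≤s (≤-trans (m≤m+n k (2 * k)) (n≤1+n (3 * k)))

  k+d≤2d : k + d ≤ 2 * d
  k+d≤2d = ≤-trans (+-monoˡ-≤ d (n≤1+n k)) (≤-reflexive (cong (d +_) (≡.sym (+-identityʳ d))))

  InBand-N∸ : ∀ {t} → InBand t → InBand (N ∸ t)
  InBand-N∸ {t} (d≤t , t<2d) =
      m+n≤o⇒m≤o∸n d (≤-pred (≤-trans (+-monoʳ-< d t<2d) (≤-reflexive (≡.sym 1+N≡d+2d))))
    , m<n+o⇒m∸n<o N t (≤-trans (≤-reflexive 1+N≡d+2d) (+-monoˡ-≤ (2 * d) d≤t))

  Adj-sym : ∀ {x y} → Adj x y → Adj y x
  Adj-sym = Sum.swap

  Adj⇒InBand : ∀ {x y} → x ≤ y → y < N → Adj x y → InBand (y ∸ x)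
  Adj⇒InBand x≤y y<N (inj₁ s) = ≡.subst InBand (n≤m⇒m⊖n≡m∸n x≤y y<N) s
  Adj⇒InBand {x} {y} x≤y y<N (inj₂ s) with m≤n⇒m<n∨m≡n x≤y
  ... | inj₂ refl = ≡.subst InBand (n≤m⇒m⊖n≡m∸n x≤y y<N) s
  ... | inj₁ x<y  = ≡.subst InBand (m∸[m∸n]≡n (≤-trans (m∸n≤m y x) (<⇒≤ y<N)))
                      (InBand-N∸ (≡.subst InBand (m<n⇒m⊖n≡N∸[n∸m] x<y y<N) s))

  InBand⇒Adj : ∀ {x y} → x ≤ y → y < N → InBand (y ∸ x) → Adj x y
  InBand⇒Adj x≤y y<N s = inj₁ (≡.subst InBand (≡.sym (n≤m⇒m⊖n≡m∸n x≤y y<N)) s)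

  Adj-⊖⁺ : ∀ {p x y} → p ≤ N → x ≤ N → y ≤ N → Adj x y → Adj (x ⊖ p) (y ⊖ p)
  Adj-⊖⁺ {p} {x} {y} p≤N x≤N y≤N = Sum.map
    (≡.subst InBand (≡.sym ([m⊖o]⊖[n⊖o]≡m⊖n y x≤N p≤N)))
    (≡.subst InBand (≡.sym ([m⊖o]⊖[n⊖o]≡m⊖n x y≤N p≤N)))

  Adj-⊖⁻ : ∀ {p x y} → p ≤ N → x ≤ N → y ≤ N → Adj (x ⊖ p) (y ⊖ p) → Adj x y
  Adj-⊖⁻ {p} {x} {y} p≤N x≤N y≤N = Sum.map
    (≡.subst InBand ([m⊖o]⊖[n⊖o]≡m⊖n y x≤N p≤N))
    (≡.subst InBand ([m⊖o]⊖[n⊖o]≡m⊖n x y≤N p≤N))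

  ¬Adj-near : ∀ {x y} → x ≤ y → y < N → y < x + d → ¬ Adj x y
  ¬Adj-near {x} {y} x≤y y<N y<x+d adj =
    <⇒≱ (m<n+o⇒m∸n<o y x y<x+d) (proj₁ (Adj⇒InBand x≤y y<N adj))

  ¬Adj⇒near : ∀ {x y} → x ≤ y → y < N → y ∸ x < 2 * d → ¬ Adj x y → y ∸ x < d
  ¬Adj⇒near x≤y y<N y∸x<2d ¬adj = ≰⇒> λ d≤y∸x → ¬adj (InBand⇒Adj x≤y y<N (d≤y∸x , y∸x<2d))

  ¬Adj-block : ∀ {a x y} → x < N → y < N → a ≤ x → x < a + d → a ≤ y → y < a + d → ¬ Adj x y
  ¬Adj-block {x = x} {y} x<N y<N a≤x x<a+d a≤y y<a+d with ≤-total x y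
  ... | inj₁ x≤y = ¬Adj-near x≤y y<N (<-≤-trans y<a+d (+-monoˡ-≤ d a≤x))
  ... | inj₂ y≤x = ¬Adj-near y≤x x<N (<-≤-trans x<a+d (+-monoˡ-≤ d a≤y)) ∘ Adj-sym {x} {y}

  Adj⇒d+x≤y : ∀ {x y} → InBand x → 2 * d ≤ y → y < N → Adj x y → d + x ≤ y
  Adj⇒d+x≤y {x} {y} (_ , x<2d) 2d≤y y<N adj =
    m≤o∸n⇒m+n≤o d x≤y (proj₁ (Adj⇒InBand x≤y y<N adj))
    where
    x≤y : x ≤ y
    x≤y = <⇒≤ (<-≤-trans x<2d 2d≤y)

  d+x≤y⇒Adj : ∀ {x y} → InBand x → 2 * d ≤ y → y < N → d + x ≤ y → Adj x y
  d+x≤y⇒Adj {x} {y} (d≤x , x<2d) 2d≤y y<N d+x≤y =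
    InBand⇒Adj x≤y y<N (m+n≤o⇒m≤o∸n d d+x≤y , m<n+o⇒m∸n<o y x y<x+2d)
    where
    x≤y : x ≤ y
    x≤y = <⇒≤ (<-≤-trans x<2d 2d≤y)
    y<x+2d : y < x + 2 * d
    y<x+2d = <-trans (≡.subst (y <_) N≡k+2d y<N) (+-monoˡ-< (2 * d) (<-≤-trans (n<1+n k) d≤x))

  mid-high-Adj-cross : ∀ {x₁ x₂ y₁ y₂} → InBand x₁ → InBand x₂ →
                       2 * d ≤ y₁ → y₁ < N → 2 * d ≤ y₂ → y₂ < N →
                       Adj x₁ y₁ → Adj x₂ y₂ → Adj x₁ y₂ ⊎ Adj x₂ y₁
  mid-high-Adj-cross {x₁} {x₂} m₁ m₂ h₁ y₁<N h₂ y₂<N a₁ a₂ with ≤-total x₁ x₂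
  ... | inj₁ x₁≤x₂ = inj₁ (d+x≤y⇒Adj m₁ h₂ y₂<N
          (≤-trans (+-monoʳ-≤ d x₁≤x₂) (Adj⇒d+x≤y m₂ h₂ y₂<N a₂)))
  ... | inj₂ x₂≤x₁ = inj₂ (d+x≤y⇒Adj m₂ h₁ y₁<N
          (≤-trans (+-monoʳ-≤ d x₂≤x₁) (Adj⇒d+x≤y m₁ h₁ y₁<N a₁)))

  data Band (t : ℕ) : Fin 3 → Set where
    low  : t < d → Band t zero
    mid  : InBand t → Band t (suc zero)
    high : 2 * d ≤ t → Band t (suc (suc zero))

  band : ∀ t → Σ (Fin 3) (Band t)
  band t with t <? d | t <? 2 * d
  ... | yes t<d | _        = _ , low t<d
  ... | no t≮d  | yes t<2d = _ , mid (≮⇒≥ t≮d , t<2d)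
  ... | no _    | no t≮2d  = _ , high (≮⇒≥ t≮2d)

  Band-¬Adj : ∀ {x y i} → x < N → y < N → Band x i → Band y i → ¬ Adj x y
  Band-¬Adj x<N y<N (low x<d) (low y<d) = ¬Adj-block x<N y<N z≤n x<d z≤n y<d
  Band-¬Adj x<N y<N (mid (d≤x , x<2d)) (mid (d≤y , y<2d)) =
    ¬Adj-block x<N y<N d≤x (<2d⇒<d+d x<2d) d≤y (<2d⇒<d+d y<2d)
    where
    <2d⇒<d+d : ∀ {t} → t < 2 * d → t < d + d
    <2d⇒<d+d {t} = ≡.subst (t <_) (cong (d +_) (+-identityʳ d))
  Band-¬Adj x<N y<N (high 2d≤x) (high 2d≤y) =
    ¬Adj-block x<N y<N 2d≤x (<N⇒<2d+d x<N) 2d≤y (<N⇒<2d+d y<N)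
    where
    <N⇒<2d+d : ∀ {t} → t < N → t < 2 * d + d
    <N⇒<2d+d t<N = <-trans t<N (≤-reflexive (≡.trans 1+N≡d+2d (+-comm d (2 * d))))

  <d⇒Band-zero : ∀ {t i} → t < d → Band t i → i ≡ zero
  <d⇒Band-zero _ (low _) = refl
  <d⇒Band-zero t<d (mid (d≤t , _)) = contradiction d≤t (<⇒≱ t<d)
  <d⇒Band-zero t<d (high 2d≤t) = contradiction (≤-trans (m≤m+n d (d + 0)) 2d≤t) (<⇒≱ t<d)

  Band-zero⇒<d : ∀ {t} → Band t zero → t < d
  Band-zero⇒<d (low t<d) = t<d

  Band-orient : ∀ {x y i j} → x < N → y < N → Band x i → Band y j → i ≢ zero → j ≢ zero →
                Adj x y → (InBand x × 2 * d ≤ y) ⊎ (InBand y × 2 * d ≤ x)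
  Band-orient _ _ (low _) _ i≢0 _ _ = contradiction refl i≢0
  Band-orient _ _ _ (low _) _ j≢0 _ = contradiction refl j≢0
  Band-orient x<N y<N bx@(mid _) by@(mid _) _ _ adj = ⊥-elim (Band-¬Adj x<N y<N bx by adj)
  Band-orient _ _ (mid mx) (high hy) _ _ _ = inj₁ (mx , hy)
  Band-orient _ _ (high hx) (mid my) _ _ _ = inj₂ (my , hx)
  Band-orient x<N y<N bx@(high _) by@(high _) _ _ adj = ⊥-elim (Band-¬Adj x<N y<N bx by adj)

  -- Rotating an element u of S to position k puts all of S into [0, 2k]; the leftmost element
  -- of S there is the start of the arc.
  independent⇒arc : ∀ {n} (f : Fin n → ℕ) → (∀ v → f v < N) → (S : Subset n) →
                    (∀ u v → u ∈ S → v ∈ S → ¬ Adj (f u) (f v)) →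
                    Σ ℕ λ p → p < N × (∀ v → v ∈ S → f v ⊖ p < d)
  independent⇒arc {n} f f<N S independent with any? (_∈? S)
  ... | no S-empty = 0 , s≤s z≤n , λ v v∈S → contradiction (v , v∈S) S-empty
  ... | yes (u , u∈S) = f a , f<N a , arc
    where
    p₀ : ℕ
    p₀ = f u ⊖ k

    p₀≤N : p₀ ≤ N
    p₀≤N = <⇒≤ (m⊖n<N (f u) k)

    q : Fin n → ℕ
    q v = f v ⊖ p₀

    q<N : ∀ v → q v < N
    q<N v = m⊖n<N (f v) p₀

    ¬Adj-q : ∀ v w → v ∈ S → w ∈ S → ¬ Adj (q v) (q w)
    ¬Adj-q v w v∈S w∈S = independent v w v∈S w∈S ∘ Adj-⊖⁻ p₀≤N (<⇒≤ (f<N v)) (<⇒≤ (f<N w))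

    q<2d : ∀ v → v ∈ S → q v < 2 * d
    q<2d v v∈S with ≤-total k (q v)
    ... | inj₂ qv≤k = ≤-<-trans qv≤k (<-≤-trans (n<1+n k) (m≤m+n d (d + 0)))
    ... | inj₁ k≤qv = begin-strict
      q v             ≤⟨ m≤n+m∸n (q v) k ⟩
      k + (q v ∸ k)   <⟨ +-monoʳ-< k (¬Adj⇒near k≤qv (q<N v) qv∸k<2d ¬adj) ⟩
      k + d           ≤⟨ k+d≤2d ⟩
      2 * d           ∎
      where
      open ≤-Reasoning
      qv∸k<2d : q v ∸ k < 2 * d
      qv∸k<2d = m<n+o⇒m∸n<o (q v) k (≡.subst (q v <_) N≡k+2d (q<N v))
      ¬adj : ¬ Adj k (q v)
      ¬adj = ≡.subst (λ t → ¬ Adj t (q v)) (m⊖[m⊖n]≡n (f u) k<N) (¬Adj-q u v u∈S v∈S)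

    members : List (Fin n)
    members = filter (_∈? S) (allFin n)

    a : Fin n
    a = argmin q u members

    a∈S : a ∈ S
    a∈S = argmin-all q u∈S (all-filter (_∈? S) (allFin n))

    a-min : ∀ v → v ∈ S → q a ≤ q v
    a-min v v∈S = All.lookup (f[argmin]≤f[xs] u members) (∈-filter⁺ (_∈? S) (∈-allFin v) v∈S)

    arc : ∀ v → v ∈ S → f v ⊖ f a < d
    arc v v∈S = ≡.subst (_< d) (≡.trans (≡.sym (n≤m⇒m⊖n≡m∸n qa≤qv (q<N v)))
                                        ([m⊖o]⊖[n⊖o]≡m⊖n (f v) (<⇒≤ (f<N a)) p₀≤N))
      (¬Adj⇒near qa≤qv (q<N v) (≤-<-trans (m∸n≤m (q v) (q a)) (q<2d v v∈S)) (¬Adj-q a v a∈S v∈S))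
      where
      qa≤qv : q a ≤ q v
      qa≤qv = a-min v v∈S

module Colouring (k : ℕ) (G : Graph) (mh : MaximalHomTo G (Andrasfai k))
                 (I₁ : VSet G) (mi : MaximalIndependent G I₁) where

  open AndrasfaiPositions k

  h : Fin (V G) → Fin N
  h = proj₁ (proj₁ mh)

  pos : Fin (V G) → ℕ
  pos v = toℕ (h v)

  pos≤N : ∀ v → pos v ≤ N
  pos≤N v = <⇒≤ (toℕ<n (h v))

  arc : Σ ℕ λ p → p < N × (∀ v → v ∈ I₁ → pos v ⊖ p < d)
  arc = independent⇒arc pos (toℕ<n ∘ h) I₁ λ u v u∈I₁ v∈I₁ →
    proj₁ mi u v u∈I₁ v∈I₁ ∘ maximal-reflects-edges G (Andrasfai k) mh u v

  p : ℕ
  p = proj₁ arc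

  p≤N : p ≤ N
  p≤N = <⇒≤ (proj₁ (proj₂ arc))

  offset : Fin (V G) → ℕ
  offset v = pos v ⊖ p

  offset<N : ∀ v → offset v < N
  offset<N v = m⊖n<N (pos v) p

  E⇒Adj : ∀ {u v} → E G u v → Adj (offset u) (offset v)
  E⇒Adj {u} {v} = Adj-⊖⁺ p≤N (pos≤N u) (pos≤N v) ∘ proj₂ (proj₁ mh) u v

  Adj⇒E : ∀ {u v} → Adj (offset u) (offset v) → E G u v
  Adj⇒E {u} {v} = maximal-reflects-edges G (Andrasfai k) mh u v ∘ Adj-⊖⁻ p≤N (pos≤N u) (pos≤N v)

  ∈I₁⇒offset<d : ∀ v → v ∈ I₁ → offset v < d
  ∈I₁⇒offset<d = proj₂ (proj₂ arc)

  ∉I₁⇒d≤offset : ∀ v → v ∉ I₁ → d ≤ offset v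
  ∉I₁⇒d≤offset v v∉I₁ with proj₂ mi v v∉I₁
  ... | u , u∈I₁ , e = ≮⇒≥ λ offset<d →
    ¬Adj-block (offset<N u) (offset<N v) z≤n (∈I₁⇒offset<d u u∈I₁) z≤n offset<d (E⇒Adj e)

  colour : Fin (V G) → Fin 3
  colour v = proj₁ (band (offset v))

  colour-band : ∀ v → Band (offset v) (colour v)
  colour-band v = proj₂ (band (offset v))

  proper : ProperColouring G 3 colour
  proper u v e same = Band-¬Adj (offset<N u) (offset<N v) (colour-band u)
    (≡.subst (Band (offset v)) (≡.sym same) (colour-band v)) (E⇒Adj e)

  colour≡zero⇔∈I₁ : ∀ v → (v ∈ I₁ → colour v ≡ zero) × (colour v ≡ zero → v ∈ I₁)
  colour≡zero⇔∈I₁ v = (λ v∈I₁ → <d⇒Band-zero (∈I₁⇒offset<d v v∈I₁) (colour-band v)) , zero⇒∈I₁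
    where
    zero⇒∈I₁ : colour v ≡ zero → v ∈ I₁
    zero⇒∈I₁ c≡0 with v ∈? I₁
    ... | yes v∈I₁ = v∈I₁
    ... | no v∉I₁  = contradiction (∉I₁⇒d≤offset v v∉I₁)
                       (<⇒≱ (Band-zero⇒<d (≡.subst (Band (offset v)) c≡0 (colour-band v))))

  Oriented : Fin (V G) → Fin (V G) → Set
  Oriented u v = InBand (offset u) × 2 * d ≤ offset v

  orient : ∀ {u v} → colour u ≢ zero → colour v ≢ zero → E G u v → Oriented u v ⊎ Oriented v u
  orient {u} {v} cu≢0 cv≢0 e =
    Band-orient (offset<N u) (offset<N v) (colour-band u) (colour-band v) cu≢0 cv≢0 (E⇒Adj e)

  cross : ∀ {x₁ y₁ x₂ y₂} → Oriented x₁ y₁ → Oriented x₂ y₂ → E G x₁ y₁ → E G x₂ y₂ →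
          E G x₁ y₂ ⊎ E G x₂ y₁
  cross {y₁ = y₁} {y₂ = y₂} (m₁ , h₁) (m₂ , h₂) e₁ e₂ =
    Sum.map Adj⇒E Adj⇒E
      (mid-high-Adj-cross m₁ m₂ h₁ (offset<N y₁) h₂ (offset<N y₂) (E⇒Adj e₁) (E⇒Adj e₂))

  no-induced-C4 : ¬ HasInducedC4InComplementOn G (λ v → colour v ≢ zero)
  no-induced-C4 (v₁ , v₂ , v₃ , v₄ , (c₁ , c₂ , c₃ , c₄) , (n₁₂ , n₂₃ , n₃₄ , n₄₁) ,
                 (v₁≢v₃ , ¬co₁₃) , (v₂≢v₄ , ¬co₂₄))
    with ¬CoE⇒E G v₁≢v₃ ¬co₁₃ | ¬CoE⇒E G v₂≢v₄ ¬co₂₄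
  ... | e₁₃ | e₂₄ with orient c₁ c₃ e₁₃ | orient c₂ c₄ e₂₄
  ... | inj₁ o₁₃ | inj₁ o₂₄ = Sum.[ proj₂ n₄₁ ∘ sym G , proj₂ n₂₃ ] (cross o₁₃ o₂₄ e₁₃ e₂₄)
  ... | inj₁ o₁₃ | inj₂ o₄₂ = Sum.[ proj₂ n₁₂ , proj₂ n₃₄ ∘ sym G ] (cross o₁₃ o₄₂ e₁₃ (sym G e₂₄))
  ... | inj₂ o₃₁ | inj₁ o₂₄ = Sum.[ proj₂ n₃₄ , proj₂ n₁₂ ∘ sym G ] (cross o₃₁ o₂₄ (sym G e₁₃) e₂₄)
  ... | inj₂ o₃₁ | inj₂ o₄₂ = Sum.[ proj₂ n₂₃ ∘ sym G , proj₂ n₄₁ ] (cross o₃₁ o₄₂ (sym G e₁₃) (sym G e₂₄))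

lemma12 : (k : ℕ) (G : Graph) → MaximalHomTo G (Andrasfai k) →
    (I₁ : VSet G) → MaximalIndependent G I₁ →
    Σ (Fin (V G) → Fin 3) λ c →
      ProperColouring G 3 c ×
      (∀ v → (v ∈ I₁ → c v ≡ zero) × (c v ≡ zero → v ∈ I₁)) ×
      ¬ HasInducedC4InComplementOn G (λ v → c v ≢ zero)
lemma12 k G mh I₁ mi = colour , proper , colour≡zero⇔∈I₁ , no-induced-C4
  where open Colouring k G mh I₁ mi
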